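{- Let $G$ be a graph, let $M^*$ be a maximum matching of $G$, and let $M$ be a maximal matching of $G$. Then $|M\cap M^*|\le 2\left(|M|-\frac12|M^*|\right)$.
   Context: A maximal matching is a matching to which no further edge of $G$ can be added while keeping it a matching. -}

module Defs where

open import Data.Nat using (ℕ)
open import Data.Fin using (Fin; _<_)
open import Data.Fin.Properties using () renaming (_≟_ to _≟ᶠ_)
open import Data.Product using (_×_; _,_; proj₁; proj₂)
open import Data.Product.Properties using (≡-dec)
open import Data.List using (List; _∷_; length; filter)
open import Data.List.Relation.Unary.All using (All)
open import Data.List.Relation.Unary.AllPairs using (AllPairs)
open import Data.List.Membership.Propositional using (_∈_; _∉_)
import Data.List.Membership.DecPropositional as DecMem
open import Relation.Binary.PropositionalEquality using (_≡_)
open import Relation.Nullary using (¬_)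
open import Level using (0ℓ)

record Graph (n : ℕ) : Set₁ where
  field
    Adj   : Fin n → Fin n → Set
    sym   : ∀ {u v} → Adj u v → Adj v u
    irrefl : ∀ {u} → ¬ Adj u u

open Graph public

-- An (undirected) edge {u,v} is represented canonically as the pair (u , v) with u < v.
Edge : ℕ → Set
Edge n = Fin n × Fin n

IsEdge : ∀ {n} → Graph n → Edge n → Set
IsEdge G (u , v) = (u < v) × Adj G u v

Disjoint : ∀ {n} → Edge n → Edge n → Set
Disjoint (a , b) (c , d) = ¬ a ≡ c × ¬ a ≡ d × ¬ b ≡ c × ¬ b ≡ d

-- a matching: a set (list) of edges of G, pairwise vertex-disjoint
-- (pairwise disjointness also forces the list to have no repetitions)
IsMatching : ∀ {n} → Graph n → List (Edge n) → Set
IsMatching G M = All (IsEdge G) M × AllPairs Disjoint M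

IsMaximumMatching : ∀ {n} → Graph n → List (Edge n) → Set
IsMaximumMatching G M = IsMatching G M ×
  (∀ M′ → IsMatching G M′ → length M′ Data.Nat.≤ length M)

IsMaximalMatching : ∀ {n} → Graph n → List (Edge n) → Set
IsMaximalMatching G M = IsMatching G M ×
  (∀ e → IsEdge G e → e ∉ M → ¬ IsMatching G (e ∷ M))

_≟ₑ_ : ∀ {n} (e f : Edge n) → Relation.Nullary.Dec (e ≡ f)
_≟ₑ_ = ≡-dec _≟ᶠ_ _≟ᶠ_

∣_∩_∣ : ∀ {n} → List (Edge n) → List (Edge n) → ℕ
∣_∩_∣ {n} M M′ = length (filter (_∈? M′) M)
  where open DecMem (_≟ₑ_ {n})

module Submission where

-- Each edge e of M* that is not in M meets, by maximality of M, an edge of M at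
-- some vertex; that edge cannot lie in M* (it would meet e inside the matching
-- M*), so it belongs to M ∖ M*.  Since the edges of M* are disjoint, the chosen
-- vertices are distinct endpoints of M ∖ M*, whence |M* ∖ M| ≤ 2|M ∖ M*|.
-- Together with |M* ∩ M| ≤ |M ∩ M*| and |M| = |M ∩ M*| + |M ∖ M*| this gives
-- |M ∩ M*| + |M*| ≤ 2|M|.

open import Defs hiding (sym)
open import Data.Nat using (ℕ; _+_; _*_; _≤_; suc; s≤s)
open import Data.Nat.Properties using (+-suc; +-mono-≤; +-monoʳ-≤; module ≤-Reasoning)
open import Data.Nat.Tactic.RingSolver using (solve-∀)
open import Data.Fin using (Fin; zero; suc; _<_)
open import Data.Fin.Properties using (injective⇒≤; <-cmp) renaming (_≟_ to _≟ᶠ_)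
open import Data.List using (List; []; _∷_; length; lookup; filter)
open import Data.List.Relation.Unary.All using (All; _∷_)
import Data.List.Relation.Unary.All as All
open import Data.List.Relation.Unary.All.Properties using (¬All⇒Any¬)
open import Data.List.Relation.Unary.Any using (here; there; index)
open import Data.List.Relation.Unary.AllPairs using (AllPairs; _∷_)
import Data.List.Relation.Unary.AllPairs as AllPairs
import Data.List.Relation.Unary.AllPairs.Properties as AllPairs
open import Data.List.Relation.Unary.Unique.Propositional using (Unique)
open import Data.List.Membership.Propositional using (_∈_; _∉_; find)
open import Data.List.Membership.Propositional.Properties using (∈-lookup; ∈-filter⁺; ∈-filter⁻)
open import Data.List.Membership.Setoid.Properties using (index-injective)
import Data.List.Membership.DecPropositional as DecMembership
open import Data.Product using (∃; _×_; _,_; proj₁; proj₂)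
open import Data.Sum using (_⊎_; inj₁; inj₂)
open import Data.Empty using (⊥; ⊥-elim)
open import Data.Bool using (true; false)
open import Function using (_∘_)
open import Relation.Nullary using (¬_; Dec; yes; no; does; ¬?; _×-dec_)
open import Relation.Unary using (Pred; Decidable)
open import Relation.Unary.Properties using (∁?)
open import Relation.Binary using (Rel; REL; Symmetric; tri<; tri≈; tri>; DecidableEquality)
open import Relation.Binary.PropositionalEquality
  using (_≡_; _≢_; refl; sym; trans; cong; subst; setoid)

module _ {a r} {A : Set a} {R : Rel A r} where

  AllPairs-lookup : ∀ {xs} → AllPairs R xs → ∀ {i j} → i < j → R (lookup xs i) (lookup xs j)
  AllPairs-lookup (Rx ∷ _)   {zero}  {suc j} _         = All.lookup Rx (∈-lookup j)
  AllPairs-lookup (_ ∷ pxs) {suc i} {suc j} (s≤s i<j) = AllPairs-lookup pxs i<j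

  AllPairs-∈ : Symmetric R → ∀ {xs x y} → AllPairs R xs → x ∈ xs → y ∈ xs → x ≢ y → R x y
  AllPairs-∈ _   (_ ∷ _)    (here refl) (here refl) x≢y = ⊥-elim (x≢y refl)
  AllPairs-∈ _   (Rx ∷ _)   (here refl) (there y∈) _    = All.lookup Rx y∈
  AllPairs-∈ sym (Rx ∷ _)   (there x∈)  (here refl) _   = sym (All.lookup Rx x∈)
  AllPairs-∈ sym (_ ∷ pxs) (there x∈)  (there y∈)  x≢y = AllPairs-∈ sym pxs x∈ y∈ x≢y

module _ {a b r} {A : Set a} {B : Set b} (R : REL A B r) where

  NoCommonPartner : Rel A _
  NoCommonPartner x x′ = ∀ {y} → R x y → R x′ y → ⊥

  length-≤-of-partners : ∀ {xs ys} → AllPairs NoCommonPartner xs →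
    All (λ x → ∃ λ y → R x y × y ∈ ys) xs → length xs ≤ length ys
  length-≤-of-partners {xs} {ys} separated partner = injective⇒≤ position-injective
    where
    partnerAt : ∀ i → ∃ λ y → R (lookup xs i) y × y ∈ ys
    partnerAt i = All.lookup partner (∈-lookup i)

    position : Fin (length xs) → Fin (length ys)
    position i = index (proj₂ (proj₂ (partnerAt i)))

    samePartner : ∀ {i j} → position i ≡ position j → proj₁ (partnerAt i) ≡ proj₁ (partnerAt j)
    samePartner {i} {j} = index-injective (setoid B) (proj₂ (proj₂ (partnerAt i))) (proj₂ (proj₂ (partnerAt j)))

    sharedPartner : ∀ {i j} → position i ≡ position j → i < j → ⊥
    sharedPartner {i} {j} eq i<j = AllPairs-lookup separated i<j
      (proj₁ (proj₂ (partnerAt i)))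
      (subst (R (lookup xs j)) (sym (samePartner eq)) (proj₁ (proj₂ (partnerAt j))))

    position-injective : ∀ {i j} → position i ≡ position j → i ≡ j
    position-injective {i} {j} eq with <-cmp i j
    ... | tri< i<j _ _ = ⊥-elim (sharedPartner eq i<j)
    ... | tri≈ _ i≡j _ = i≡j
    ... | tri> _ _ j<i = ⊥-elim (sharedPartner (sym eq) j<i)

module _ {a} {A : Set a} where

  Unique-⊆⇒length-≤ : ∀ {xs ys : List A} → Unique xs → All (_∈ ys) xs → length xs ≤ length ys
  Unique-⊆⇒length-≤ unique xs⊆ys = length-≤-of-partners _≡_
    (AllPairs.map (λ { x≢x′ refl refl → x≢x′ refl }) unique)
    (All.map (λ x∈ys → _ , refl , x∈ys) xs⊆ys)

  length-filter-+-∁ : ∀ {p} {P : Pred A p} (P? : Decidable P) xs →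
    length (filter P? xs) + length (filter (∁? P?) xs) ≡ length xs
  length-filter-+-∁ P? [] = refl
  length-filter-+-∁ P? (x ∷ xs) with does (P? x)
  ... | true  = cong suc (length-filter-+-∁ P? xs)
  ... | false = trans (+-suc _ _) (cong suc (length-filter-+-∁ P? xs))

module ListIntersection {a} {A : Set a} (_≟_ : DecidableEquality A) where

  open DecMembership _≟_ using (_∈?_; _∉?_)

  _∖_ : List A → List A → List A
  xs ∖ ys = filter (_∉? ys) xs

  length-∩-+-∖ : ∀ xs ys → length (filter (_∈? ys) xs) + length (xs ∖ ys) ≡ length xs
  length-∩-+-∖ xs ys = length-filter-+-∁ (_∈? ys) xs

  length-∩-comm-≤ : ∀ {xs ys} → Unique xs →
    length (filter (_∈? ys) xs) ≤ length (filter (_∈? xs) ys)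
  length-∩-comm-≤ {xs} {ys} unique = Unique-⊆⇒length-≤
    (AllPairs.filter⁺ (_∈? ys) unique)
    (All.tabulate λ x∈ → let x∈xs , x∈ys = ∈-filter⁻ (_∈? ys) {xs = xs} x∈ in
      ∈-filter⁺ (_∈? xs) x∈ys x∈xs)

module _ {n : ℕ} where

  open ListIntersection (_≟ₑ_ {n})
  open DecMembership (_≟ₑ_ {n}) using (_∉?_)

  _∈ₑ_ : Fin n → Edge n → Set
  v ∈ₑ (a , b) = v ≡ a ⊎ v ≡ b

  endpoints : List (Edge n) → List (Fin n)
  endpoints [] = []
  endpoints ((a , b) ∷ es) = a ∷ b ∷ endpoints es

  length-endpoints : ∀ es → length (endpoints es) ≡ 2 * length es
  length-endpoints [] = refl
  length-endpoints (_ ∷ es) = cong suc (trans (cong suc (length-endpoints es)) (sym (+-suc (length es) _)))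

  ∈ₑ⇒∈-endpoints : ∀ {v e es} → v ∈ₑ e → e ∈ es → v ∈ endpoints es
  ∈ₑ⇒∈-endpoints (inj₁ refl) (here refl) = here refl
  ∈ₑ⇒∈-endpoints (inj₂ refl) (here refl) = there (here refl)
  ∈ₑ⇒∈-endpoints {es = _ ∷ _} v∈ₑe (there e∈es) = there (there (∈ₑ⇒∈-endpoints v∈ₑe e∈es))

  Disjoint? : (e f : Edge n) → Dec (Disjoint e f)
  Disjoint? (a , b) (c , d) =
    ¬? (a ≟ᶠ c) ×-dec ¬? (a ≟ᶠ d) ×-dec ¬? (b ≟ᶠ c) ×-dec ¬? (b ≟ᶠ d)

  Disjoint-sym : Symmetric (Disjoint {n})
  Disjoint-sym (a≢c , a≢d , b≢c , b≢d) = a≢c ∘ sym , b≢c ∘ sym , a≢d ∘ sym , b≢d ∘ sym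

  Disjoint⇒≢ : {e f : Edge n} → Disjoint e f → e ≢ f
  Disjoint⇒≢ (a≢a , _) refl = a≢a refl

  Disjoint⇒NoCommonEndpoint : {e f : Edge n} → Disjoint e f → NoCommonPartner (λ e v → v ∈ₑ e) e f
  Disjoint⇒NoCommonEndpoint (a≢c , _ , _ , _) (inj₁ refl) (inj₁ refl) = a≢c refl
  Disjoint⇒NoCommonEndpoint (_ , a≢d , _ , _) (inj₁ refl) (inj₂ refl) = a≢d refl
  Disjoint⇒NoCommonEndpoint (_ , _ , b≢c , _) (inj₂ refl) (inj₁ refl) = b≢c refl
  Disjoint⇒NoCommonEndpoint (_ , _ , _ , b≢d) (inj₂ refl) (inj₂ refl) = b≢d refl

  ¬Disjoint⇒commonEndpoint : ∀ e f → ¬ Disjoint e f → ∃ λ v → v ∈ₑ e × v ∈ₑ f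
  ¬Disjoint⇒commonEndpoint (a , b) (c , d) ¬disjoint with a ≟ᶠ c | a ≟ᶠ d | b ≟ᶠ c | b ≟ᶠ d
  ... | yes a≡c | _       | _       | _       = a , inj₁ refl , inj₁ a≡c
  ... | no _    | yes a≡d | _       | _       = a , inj₁ refl , inj₂ a≡d
  ... | no _    | no _    | yes b≡c | _       = b , inj₂ refl , inj₁ b≡c
  ... | no _    | no _    | no _    | yes b≡d = b , inj₂ refl , inj₂ b≡d
  ... | no a≢c  | no a≢d  | no b≢c  | no b≢d  = ⊥-elim (¬disjoint (a≢c , a≢d , b≢c , b≢d))

  matching-Unique : ∀ (G : Graph n) {M} → IsMatching G M → Unique M
  matching-Unique _ (_ , disjoint) = AllPairs.map Disjoint⇒≢ disjoint

  module _ (G : Graph n) {M* M : List (Edge n)} (matching* : IsMatching G M*) (maximal : IsMaximalMatching G M) where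

    maximal-meets : ∀ {e} → IsEdge G e → e ∉ M → ∃ λ f → f ∈ M × ¬ Disjoint e f
    maximal-meets {e} edge e∉M = find (¬All⇒Any¬ (Disjoint? e) M λ disjoint →
      proj₂ maximal e edge e∉M ((edge ∷ proj₁ (proj₁ maximal)) , (disjoint ∷ proj₂ (proj₁ maximal))))

    ∖-meets-∖ : ∀ {e} → e ∈ M* ∖ M → ∃ λ v → v ∈ₑ e × v ∈ endpoints (M ∖ M*)
    ∖-meets-∖ {e} e∈M*∖M
      with e∈M* , e∉M ← ∈-filter⁻ (_∉? M) {xs = M*} e∈M*∖M
      with f , f∈M , e-meets-f ← maximal-meets (All.lookup (proj₁ matching*) e∈M*) e∉M
      with v , v∈e , v∈f ← ¬Disjoint⇒commonEndpoint e f e-meets-f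
      = v , v∈e , ∈ₑ⇒∈-endpoints v∈f (∈-filter⁺ (_∉? M*) f∈M f∉M*)
      where
      f∉M* : f ∉ M*
      f∉M* f∈M* = e-meets-f (AllPairs-∈ Disjoint-sym (proj₂ matching*) e∈M* f∈M* λ { refl → e∉M f∈M })

    length-∖-≤ : length (M* ∖ M) ≤ 2 * length (M ∖ M*)
    length-∖-≤ = begin
      length (M* ∖ M)             ≤⟨ length-≤-of-partners (λ e v → v ∈ₑ e)
                                       (AllPairs.map Disjoint⇒NoCommonEndpoint
                                         (AllPairs.filter⁺ (_∉? M) (proj₂ matching*)))
                                       (All.tabulate ∖-meets-∖) ⟩
      length (endpoints (M ∖ M*)) ≡⟨ length-endpoints (M ∖ M*) ⟩
      2 * length (M ∖ M*)         ∎
      where open ≤-Reasoning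

lemma1 : ∀ {n} (G : Graph n) (M* M : List (Edge n)) →
    IsMaximumMatching G M* → IsMaximalMatching G M →
    ∣ M ∩ M* ∣ + length M* ≤ 2 * length M
lemma1 {n} G M* M (matching* , _) maximal = begin
  k + length M*                     ≡⟨ cong (k +_) (length-∩-+-∖ M* M) ⟨
  k + (∣ M* ∩ M ∣ + length (M* ∖ M)) ≤⟨ +-monoʳ-≤ k (+-mono-≤ (length-∩-comm-≤ (matching-Unique G matching*))
                                                              (length-∖-≤ G matching* maximal)) ⟩
  k + (k + 2 * length (M ∖ M*))      ≡⟨ double-sum k (length (M ∖ M*)) ⟩
  2 * (k + length (M ∖ M*))          ≡⟨ cong (2 *_) (length-∩-+-∖ M M*) ⟩
  2 * length M                       ∎
  where
  open ListIntersection (_≟ₑ_ {n})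
  open ≤-Reasoning
  k : ℕ
  k = ∣ M ∩ M* ∣
  double-sum : ∀ k b → k + (k + 2 * b) ≡ 2 * (k + b)
  double-sum = solve-∀
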